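{- Let $\mathcal{F}$ be a 2-generic $\mathbb{Q}_1$-filter. Then there is some $p \in \mathcal{F}$ such that $p \Vdash (\forall n)(\exists m)\neg\Phi(G, n, m)$, where $\Phi(G, n, m)$ is the $\Delta_0$ formula $m \leq n \vee m \notin G$ (i.e. $p$ forces $(\forall n)(\exists m)[m > n \wedge m \in G]$).
   Context: A binary string $\sigma$ is identified with the finite set $F_\sigma = \{x < |\sigma| : \sigma(x) = 1\}$; for strings, $\sigma \cup \rho$, $\tau - \sigma$ refer to these finite sets, $\rho \subseteq X$ means $F_\rho \subseteq X$, and $\sigma \preceq \tau$ is the prefix relation; $\Phi_e(\sigma, n, m)$ means the formula evaluated with $G = F_\sigma$. Fix an effective enumeration $\mathcal{U}_0, \mathcal{U}_1, \dots$ of all $\Sigma^0_1$ classes in $2^\omega$ upward closed under $\supseteq$. A largeness class is a class $\mathcal{A} \subseteq 2^\omega$ upward closed under $\supseteq$ such that for every $k$-cover $Y_0 \cup \dots \cup Y_{k-1} \supseteq \omega$ some $Y_j \in \mathcal{A}$. Let $\zeta$ be the computable function with $\mathcal{U}_{\zeta(e,\sigma,n)} = \{X : (\exists \rho \subseteq X - \{0,\dots,|\sigma|\})(\exists m)\neg\Phi_e(\sigma \cup \rho, n, m)\}$ for every index $e$ of a $\Delta_0$ formula $\Phi_e(G,n,m)$, string $\sigma$ and $n$. $\mathbb{Q}_1$ is the set of tuples $(\sigma, X, C, U)$ ($\sigma$ a binary string, $X, C, U \subseteq \omega$) with $X \cap \{0, \dots, |\sigma|\} = \emptyset$, $U \subseteq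 X$, $\bigcap_{e \in C}\mathcal{U}_e$ a largeness class containing only infinite sets, and $U \in \bigcap_{e \in C}\mathcal{U}_e$; ordered by $(\tau, Y, D, V) \leq (\sigma, X, C, U)$ iff $\sigma \preceq \tau$, $Y \subseteq X$, $V \subseteq U$, $C \subseteq D$, $\tau - \sigma \subseteq U$. For $p = (\sigma, X, C, U)$: $p \Vdash (\exists n)(\forall m)\Phi_e(G,n,m)$ iff there is $n$ with $\Phi_e(\sigma \cup \tau, n, m)$ for every string $\tau \subseteq X$ and every $m$; $p \Vdash (\forall n)(\exists m)\neg\Phi_e(G,n,m)$ iff $\zeta(e, \sigma \cup \rho, n) \in C$ for every string $\rho \subseteq U$ and every $n$. A $\mathbb{Q}_1$-filter is a nonempty $\mathcal{F} \subseteq \mathbb{Q}_1$ upward closed under $\leq$ in which any two elements have a common lower bound in $\mathcal{F}$; it is 2-generic if for every $\Delta_0$ formula $\Phi_e(G,n,m)$ some $p \in \mathcal{F}$ satisfies $p \Vdash (\exists n)(\forall m)\Phi_e(G,n,m)$ or $p \Vdash (\forall n)(\exists m)\neg\Phi_e(G,n,m)$. -}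

module Defs where

open import Data.Nat using (ℕ; zero; suc; _+_; _*_; _<_; _≤ᵇ_; _≡ᵇ_)
open import Data.Bool using (Bool; true; false; _∧_; _∨_; not)
open import Data.List using (List; []; _∷_; length; _++_)
open import Data.Fin using (Fin)
import Data.Fin as Fin
open import Data.Product using (Σ; _×_; ∃; ∃-syntax)
open import Relation.Binary.PropositionalEquality using (_≡_)
open import Function.Bundles using (_⇔_)
import Data.Sum

NSet : Set
NSet = ℕ → Bool

Class : Set₁
Class = NSet → Set

_⊆ˢ_ : NSet → NSet → Set
Y ⊆ˢ X = ∀ x → Y x ≡ true → X x ≡ true

UpwardClosed : Class → Set
UpwardClosed 𝒜 = ∀ X Y → 𝒜 X → X ⊆ˢ Y → 𝒜 Y

Infinite : NSet → Set
Infinite X = ∀ n → ∃[ m ] (n < m × X m ≡ true)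

IsCover : (k : ℕ) → (Fin k → NSet) → Set
IsCover k Y = ∀ x → ∃[ j ] (Y j x ≡ true)

LargenessClass : Class → Set
LargenessClass 𝒜 =
  UpwardClosed 𝒜 × (∀ k (Y : Fin k → NSet) → IsCover k Y → ∃[ j ] 𝒜 (Y j))

-- Binary strings, identified with finite sets.

Str : Set
Str = List Bool

at : Str → ℕ → Bool
at []      _       = false
at (b ∷ σ) zero    = b
at (b ∷ σ) (suc x) = at σ x

_∪ˢ_ : Str → Str → Str
[]      ∪ˢ ρ       = ρ
(b ∷ σ) ∪ˢ []      = b ∷ σ
(b ∷ σ) ∪ˢ (c ∷ ρ) = (b ∨ c) ∷ (σ ∪ˢ ρ)

_⊆ₛ_ : Str → NSet → Set
ρ ⊆ₛ X = ∀ x → at ρ x ≡ true → X x ≡ true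

DiffSub : Str → Str → NSet → Set
DiffSub τ σ X = ∀ x → at τ x ≡ true → at σ x ≡ false → X x ≡ true

_≼_ : Str → Str → Set
σ ≼ τ = ∃[ ρ ] (τ ≡ σ ++ ρ)

-- Δ₀ formulas in the language of arithmetic with a set variable G,
-- with k free number variables (de Bruijn indices).

data Term (k : ℕ) : Set where
  var  : Fin k → Term k
  zer  : Term k
  succ : Term k → Term k
  plus : Term k → Term k → Term k
  mult : Term k → Term k → Term k

data Δ₀ (k : ℕ) : Set where
  leq  : Term k → Term k → Δ₀ k
  eq   : Term k → Term k → Δ₀ k
  mem  : Term k → Δ₀ k
  neg  : Δ₀ k → Δ₀ k
  and  : Δ₀ k → Δ₀ k → Δ₀ k
  or   : Δ₀ k → Δ₀ k → Δ₀ k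
  all< : Term k → Δ₀ (suc k) → Δ₀ k  -- (∀ x < t) φ, x = var zero
  ex<  : Term k → Δ₀ (suc k) → Δ₀ k

Env : ℕ → Set
Env k = Fin k → ℕ

extend : ∀ {k} → ℕ → Env k → Env (suc k)
extend a ρ Fin.zero    = a
extend a ρ (Fin.suc i) = ρ i

evalT : ∀ {k} → Env k → Term k → ℕ
evalT ρ (var i)    = ρ i
evalT ρ zer        = 0
evalT ρ (succ t)   = suc (evalT ρ t)
evalT ρ (plus s t) = evalT ρ s + evalT ρ t
evalT ρ (mult s t) = evalT ρ s * evalT ρ t

allBelow : ℕ → (ℕ → Bool) → Bool
allBelow zero    f = true
allBelow (suc n) f = allBelow n f ∧ f n

exBelow : ℕ → (ℕ → Bool) → Bool
exBelow zero    f = false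
exBelow (suc n) f = exBelow n f ∨ f n

eval : ∀ {k} → Str → Env k → Δ₀ k → Bool
eval G ρ (leq s t)  = evalT ρ s ≤ᵇ evalT ρ t
eval G ρ (eq s t)   = evalT ρ s ≡ᵇ evalT ρ t
eval G ρ (mem t)    = at G (evalT ρ t)
eval G ρ (neg φ)    = not (eval G ρ φ)
eval G ρ (and φ ψ)  = eval G ρ φ ∧ eval G ρ ψ
eval G ρ (or φ ψ)   = eval G ρ φ ∨ eval G ρ ψ
eval G ρ (all< t φ) = allBelow (evalT ρ t) (λ a → eval G (extend a ρ) φ)
eval G ρ (ex< t φ)  = exBelow (evalT ρ t) (λ a → eval G (extend a ρ) φ)

-- formulas Φ(G, n, m): n = var 0, m = var 1
Formula : Set
Formula = Δ₀ 2

env2 : ℕ → ℕ → Env 2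
env2 n m Fin.zero           = n
env2 n m (Fin.suc Fin.zero) = m

Holds : Formula → Str → ℕ → ℕ → Set
Holds Φ σ n m = eval σ (env2 n m) Φ ≡ true

Enumeration : Set₁
Enumeration = ℕ → Class

ZetaSpec : Enumeration → (Formula → Str → ℕ → ℕ) → Set
ZetaSpec 𝒰 ζ = ∀ Φ σ n X →
  𝒰 (ζ Φ σ n) X ⇔
    (∃[ ρ ] ((∀ x → at ρ x ≡ true → (X x ≡ true × length σ < x))
             × ∃[ m ] (eval (σ ∪ˢ ρ) (env2 n m) Φ ≡ false)))

Inter : Enumeration → NSet → Class
Inter 𝒰 C X = ∀ e → C e ≡ true → 𝒰 e X

record Tuple : Set where
  constructor ⟨_,_,_,_⟩
  field
    σ : Str
    X : NSet
    C : NSet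
    U : NSet
open Tuple public

InQ1 : Enumeration → Tuple → Set
InQ1 𝒰 ⟨ σ , X , C , U ⟩ =
  (∀ x → x Data.Nat.≤ length σ → X x ≡ false)
  × U ⊆ˢ X
  × LargenessClass (Inter 𝒰 C)
  × (∀ Y → Inter 𝒰 C Y → Infinite Y)
  × Inter 𝒰 C U

_≤Q_ : Tuple → Tuple → Set
⟨ τ , Y , D , V ⟩ ≤Q ⟨ σ , X , C , U ⟩ =
  σ ≼ τ × Y ⊆ˢ X × V ⊆ˢ U × C ⊆ˢ D × DiffSub τ σ U

ForcesΣ : Tuple → Formula → Set
ForcesΣ ⟨ σ , X , C , U ⟩ Φ =
  ∃[ n ] (∀ τ → τ ⊆ₛ X → ∀ m → Holds Φ (σ ∪ˢ τ) n m)

ForcesΠ : (Formula → Str → ℕ → ℕ) → Tuple → Formula → Set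
ForcesΠ ζ ⟨ σ , X , C , U ⟩ Φ =
  ∀ ρ → ρ ⊆ₛ U → ∀ n → C (ζ Φ (σ ∪ˢ ρ) n) ≡ true

IsFilter : Enumeration → (Tuple → Set) → Set
IsFilter 𝒰 F =
  (∀ p → F p → InQ1 𝒰 p)
  × (∃[ p ] F p)
  × (∀ p q → F q → InQ1 𝒰 p → q ≤Q p → F p)
  × (∀ p q → F p → F q → ∃[ r ] (F r × r ≤Q p × r ≤Q q))

Is2Generic : Enumeration → (Formula → Str → ℕ → ℕ) → (Tuple → Set) → Set
Is2Generic 𝒰 ζ F =
  IsFilter 𝒰 F
  × (∀ Φ → ∃[ p ] (F p × (ForcesΣ p Φ Data.Sum.⊎ ForcesΠ ζ p Φ)))

ΦInf : Formula
ΦInf = or (leq (var (Fin.suc Fin.zero)) (var Fin.zero))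
          (neg (mem (var (Fin.suc Fin.zero))))

module Submission where

-- A filter of conditions in ℚ₁ cannot force (∃n)(∀m)[m ≤ n ∨ m ∉ G]: the
-- reservoir X of any condition contains the infinite set U, so above any
-- candidate bound n there is an m ∈ X, and extending the stem by {m} refutes
-- the bound. Genericity therefore leaves only the Π-alternative.

open import Defs
open import Data.Nat using (ℕ; zero; suc; _≤_; _<_; _≤ᵇ_)
open import Data.Nat.Properties using (≤ᵇ⇒≤; <⇒≱)
open import Data.Bool using (Bool; true; false; _∨_; not)
open import Data.Bool.Properties using (∨-identityʳ; ∨-zeroʳ; T-≡)
open import Data.List using ([]; _∷_)
open import Data.Product using (∃-syntax; _×_; _,_)
open import Data.Sum using (inj₁; inj₂)
open import Data.Empty using (⊥-elim)
open import Function.Bundles using (Equivalence)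
open import Relation.Nullary using (¬_)
open import Relation.Binary.PropositionalEquality
  using (_≡_; refl; sym; cong; subst; module ≡-Reasoning)

singleton : ℕ → Str
singleton zero    = true ∷ []
singleton (suc m) = false ∷ singleton m

at-singleton⇒≡ : ∀ m x → at (singleton m) x ≡ true → x ≡ m
at-singleton⇒≡ zero    zero    _  = refl
at-singleton⇒≡ (suc m) (suc x) x∈m = cong suc (at-singleton⇒≡ m x x∈m)

at-singleton-self : ∀ m → at (singleton m) m ≡ true
at-singleton-self zero    = refl
at-singleton-self (suc m) = at-singleton-self m

singleton-⊆ₛ : ∀ {X m} → X m ≡ true → singleton m ⊆ₛ X
singleton-⊆ₛ {X} {m} m∈X x x∈m =
  subst (λ y → X y ≡ true) (sym (at-singleton⇒≡ m x x∈m)) m∈X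

at-∪ˢ-inj₂ : ∀ σ τ x → at τ x ≡ true → at (σ ∪ˢ τ) x ≡ true
at-∪ˢ-inj₂ []      τ       x       x∈τ = x∈τ
at-∪ˢ-inj₂ (b ∷ σ) (c ∷ τ) zero    x∈τ = subst (λ c → b ∨ c ≡ true) (sym x∈τ) (∨-zeroʳ b)
at-∪ˢ-inj₂ (b ∷ σ) (c ∷ τ) (suc x) x∈τ = at-∪ˢ-inj₂ σ τ x x∈τ

Infinite-⊆ˢ : ∀ {Y X} → Y ⊆ˢ X → Infinite Y → Infinite X
Infinite-⊆ˢ Y⊆X Y-inf n with Y-inf n
... | m , n<m , m∈Y = m , n<m , Y⊆X m m∈Y

InQ1⇒Infinite-X : ∀ 𝒰 p → InQ1 𝒰 p → Infinite (X p)
InQ1⇒Infinite-X 𝒰 p (_ , U⊆X , _ , allInfinite , U∈⋂) =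
  Infinite-⊆ˢ U⊆X (allInfinite (U p) U∈⋂)

Holds-ΦInf⇒≤ : ∀ τ {n m} → Holds ΦInf τ n m → at τ m ≡ true → m ≤ n
Holds-ΦInf⇒≤ τ {n} {m} holds m∈τ =
  ≤ᵇ⇒≤ m n (Equivalence.from T-≡ m≤ᵇn)
  where
    open ≡-Reasoning
    m≤ᵇn : (m ≤ᵇ n) ≡ true
    m≤ᵇn = begin
      m ≤ᵇ n                  ≡⟨ sym (∨-identityʳ (m ≤ᵇ n)) ⟩
      (m ≤ᵇ n) ∨ not true     ≡⟨ cong (λ b → (m ≤ᵇ n) ∨ not b) (sym m∈τ) ⟩
      (m ≤ᵇ n) ∨ not (at τ m) ≡⟨ holds ⟩
      true                    ∎

Infinite⇒¬ForcesΣ-ΦInf : ∀ σ X C U → Infinite X → ¬ ForcesΣ ⟨ σ , X , C , U ⟩ ΦInf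
Infinite⇒¬ForcesΣ-ΦInf σ X C U X-inf (n , forces) with X-inf n
... | m , n<m , m∈X = <⇒≱ n<m (Holds-ΦInf⇒≤ (σ ∪ˢ τ) (forces τ τ⊆X m) m∈σ∪τ)
  where
    τ : Str
    τ = singleton m
    τ⊆X : τ ⊆ₛ X
    τ⊆X = singleton-⊆ₛ m∈X
    m∈σ∪τ : at (σ ∪ˢ τ) m ≡ true
    m∈σ∪τ = at-∪ˢ-inj₂ σ τ m (at-singleton-self m)

lemma2p28 : (𝒰 : Enumeration) (ζ : Formula → Str → ℕ → ℕ)
    → (∀ e → UpwardClosed (𝒰 e))
    → ZetaSpec 𝒰 ζ
    → (F : Tuple → Set)
    → Is2Generic 𝒰 ζ F
    → ∃[ p ] (F p × ForcesΠ ζ p ΦInf)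
lemma2p28 𝒰 ζ _ _ F ((F⊆Q1 , _) , decides) with decides ΦInf
... | p , p∈F , inj₂ forcesΠ = p , p∈F , forcesΠ
... | p@(⟨ σ , X , C , U ⟩) , p∈F , inj₁ forcesΣ =
  ⊥-elim (Infinite⇒¬ForcesΣ-ΦInf σ X C U (InQ1⇒Infinite-X 𝒰 p (F⊆Q1 p p∈F)) forcesΣ)
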